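{- Let $G$ be a triangle-free graph. For any two non-adjacent vertices $u,v\in V(G)$, the graph $G_{T_G(u)\rightarrow v}$ is triangle-free.
   Context: All graphs are finite, simple and undirected; $N_G(x)$ denotes the open neighborhood of $x$. For $x\in V(G)$, the twin set of $x$ is $T_G(x)=\{y\in V(G): N_G(y)=N_G(x)\}$. For two non-adjacent vertices $u,v$ of $G$, $G_{T_G(u)\rightarrow v}$ is the graph obtained from $G$ as follows: for every $u'\in T_G(u)$, delete the edge $u'x$ for every $x\in N_G(u)\setminus N_G(v)$ and add the edge $u'y$ for every $y\in N_G(v)\setminus N_G(u)$. -}

module Defs where

open import Data.Nat using (ℕ)
open import Data.Fin using (Fin)
open import Data.Product using (_×_; Σ)
open import Data.Sum using (_⊎_)
open import Relation.Nullary using (¬_)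
open import Relation.Binary.PropositionalEquality using (_≡_)
open import Function.Bundles using (_⇔_)
open import Data.Empty using (⊥)

record Graph (n : ℕ) : Set₁ where
  field
    Adj   : Fin n → Fin n → Set
    sym   : ∀ {x y} → Adj x y → Adj y x
    irref : ∀ {x} → ¬ Adj x x
open Graph public

TriangleFreeRel : ∀ {n} → (Fin n → Fin n → Set) → Set
TriangleFreeRel {n} R = ∀ (a b c : Fin n) → R a b → R b c → R a c → ⊥

TriangleFree : ∀ {n} → Graph n → Set
TriangleFree G = TriangleFreeRel (Adj G)

-- y ∈ T_G(x):  N_G(y) = N_G(x)  (as sets of vertices)
InTwin : ∀ {n} → Graph n → Fin n → Fin n → Set
InTwin G x y = ∀ z → (Adj G y z ⇔ Adj G x z)

-- adjacency of G_{T_G(u) → v}, exactly as in the definition: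
-- for every u' ∈ T_G(u), delete u'x for x ∈ N(u) \ N(v),
-- add u'y for y ∈ N(v) \ N(u).
Deleted : ∀ {n} → Graph n → Fin n → Fin n → Fin n → Fin n → Set
Deleted G u v a b = InTwin G u a × (Adj G u b × ¬ Adj G v b)

Added : ∀ {n} → Graph n → Fin n → Fin n → Fin n → Fin n → Set
Added G u v a b = InTwin G u a × (Adj G v b × ¬ Adj G u b)

MoveAdj : ∀ {n} → Graph n → Fin n → Fin n → Fin n → Fin n → Set
MoveAdj G u v a b =
  (Adj G a b × ¬ Deleted G u v a b × ¬ Deleted G u v b a)
  ⊎ (Added G u v a b ⊎ Added G u v b a)

module Submission where

-- Write H for the moved graph G_{T(u)→v}.  Only edges at
-- twins of u change, and H still has two kinds of edges: kept edges of G
-- and added edges, each of which has an end in T(u).  Hence: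
--   * between two non-twins of u, H-adjacency is G-adjacency;
--   * no two twins of u are H-adjacent (twins share a neighbourhood, so they
--     are non-adjacent in G, and an added edge would make u adjacent to v);
--   * every H-neighbour of a twin lies in N_G(v) (up to double negation):
--     a kept edge into N(u) \ N(v) would have been deleted.
-- So a triangle of H through a twin a has its other two vertices b, c
-- non-twins, adjacent in G and both in N_G(v); then v b c is a triangle of
-- G.  A triangle of H with no added edge is a triangle of G.

open import Defs
open import Data.Fin using (Fin)
open import Relation.Nullary using (¬_)
open import Data.Product using (_,_)
open import Data.Sum using (inj₁; inj₂)
open import Data.Empty using (⊥; ⊥-elim)
open import Function.Bundles using (Equivalence)

module _ {n} (G : Graph n) where

  twin-to : ∀ {u a} → InTwin G u a → ∀ z → Adj G a z → Adj G u z
  twin-to t z = Equivalence.to (t z)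

  -- Two vertices with the same neighbourhood are never adjacent:
  -- a ~ b would give b ∈ N(u), so u ∈ N(b) = N(u), contradicting irreflexivity.
  twins-nonadjacent : ∀ {u a b} → InTwin G u a → InTwin G u b → ¬ Adj G a b
  twins-nonadjacent {u} {a} {b} ta tb ab =
    irref G (twin-to tb u (sym G (twin-to ta b ab)))

module Moved {n} (G : Graph n) (u v : Fin n) (u≁v : ¬ Adj G u v) where

  H : Fin n → Fin n → Set
  H = MoveAdj G u v

  H-sym : ∀ {a b} → H a b → H b a
  H-sym (inj₁ (ab , ¬del-ab , ¬del-ba)) = inj₁ (sym G ab , ¬del-ba , ¬del-ab)
  H-sym (inj₂ (inj₁ add-ab))            = inj₂ (inj₂ add-ab)
  H-sym (inj₂ (inj₂ add-ba))            = inj₂ (inj₁ add-ba)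

  -- No two twins of u are adjacent in H.  An added edge would put a twin
  -- into N(v), i.e. v ∈ N(twin) = N(u).
  twins-nonadjacent-in-H : ∀ {a b} → InTwin G u a → InTwin G u b → ¬ H a b
  twins-nonadjacent-in-H ta tb (inj₁ (ab , _)) = twins-nonadjacent G ta tb ab
  twins-nonadjacent-in-H ta tb (inj₂ (inj₁ (_ , vb , _))) =
    u≁v (twin-to G tb v (sym G vb))
  twins-nonadjacent-in-H ta tb (inj₂ (inj₂ (_ , va , _))) =
    u≁v (twin-to G ta v (sym G va))

  H-between-nontwins : ∀ {a b} → H a b → ¬ InTwin G u a → ¬ InTwin G u b → Adj G a b
  H-between-nontwins (inj₁ (ab , _)) _ _     = ab
  H-between-nontwins (inj₂ (inj₁ (ta , _))) ¬ta _ = ⊥-elim (¬ta ta)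
  H-between-nontwins (inj₂ (inj₂ (tb , _))) _ ¬tb = ⊥-elim (¬tb tb)

  -- Every H-neighbour of a twin of u is (not not) a G-neighbour of v:
  -- a kept edge a b with b ∉ N(v) has b ∈ N(u) \ N(v), so it was deleted.
  H-neighbour-of-twin : ∀ {a b} → InTwin G u a → H a b → ¬ ¬ Adj G v b
  H-neighbour-of-twin {b = b} ta (inj₁ (ab , ¬del-ab , _)) v≁b =
    ¬del-ab (ta , twin-to G ta b ab , v≁b)
  H-neighbour-of-twin ta (inj₂ (inj₁ (_ , vb , _))) v≁b = v≁b vb
  H-neighbour-of-twin ta ab@(inj₂ (inj₂ (tb , _))) _  =
    twins-nonadjacent-in-H ta tb ab

  -- In a triangle-free G, no triangle of H passes through a twin of u:
  -- its other vertices b, c are non-twins, adjacent in G and in N(v).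
  no-triangle-at-twin : TriangleFree G →
    ∀ {a b c} → InTwin G u a → H a b → H b c → H a c → ⊥
  no-triangle-at-twin tf {b = b} {c} ta ab bc ac =
    H-neighbour-of-twin ta ab λ vb →
    H-neighbour-of-twin ta ac λ vc →
    tf v b c vb bc-in-G vc
    where
    bc-in-G : Adj G b c
    bc-in-G = H-between-nontwins bc (λ tb → twins-nonadjacent-in-H ta tb ab)
                                    (λ tc → twins-nonadjacent-in-H ta tc ac)

-- Main theorem.  An added edge of the triangle has a twin at one end; rotate
-- the triangle so that this twin comes first.  Otherwise all three edges are
-- kept edges of G.
lemma3 : ∀ {n} (G : Graph n) → TriangleFree G →
    ∀ (u v : Fin n) → ¬ Adj G u v → TriangleFreeRel (MoveAdj G u v)
lemma3 G tf u v u≁v = triangle-free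
  where
  open Moved G u v u≁v

  triangle-free : TriangleFreeRel H
  triangle-free a b c ab@(inj₂ (inj₁ (ta , _))) bc ac = no-triangle-at-twin tf ta ab bc ac
  triangle-free a b c ab@(inj₂ (inj₂ (tb , _))) bc ac = no-triangle-at-twin tf tb (H-sym ab) ac bc
  triangle-free a b c ab bc@(inj₂ (inj₁ (tb , _))) ac = no-triangle-at-twin tf tb (H-sym ab) ac bc
  triangle-free a b c ab bc@(inj₂ (inj₂ (tc , _))) ac = no-triangle-at-twin tf tc (H-sym ac) ab (H-sym bc)
  triangle-free a b c ab bc ac@(inj₂ (inj₁ (ta , _))) = no-triangle-at-twin tf ta ab bc ac
  triangle-free a b c ab bc ac@(inj₂ (inj₂ (tc , _))) = no-triangle-at-twin tf tc (H-sym ac) ab (H-sym bc)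
  triangle-free a b c (inj₁ (ab , _)) (inj₁ (bc , _)) (inj₁ (ac , _)) = tf a b c ab bc ac
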